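{- For any time warps $f,g$: (a) $f\backslash g=f^{r}g\vee(\top f)^{r}\vee g^{o}$; (b) $g/f=g f^{\ell}\vee (f^{\ell})^{o}$.
   Context: Let $\overline{\omega}=\omega\cup\{\omega\}$ with its natural order. A time warp is a function $f:\overline{\omega}\to\overline{\omega}$ preserving all suprema; equivalently, a monotone function with $f(0)=0$ and $f(\omega)=\bigvee\{f(n)\mid n\in\omega\}$. The set $W$ of time warps is ordered pointwise with pointwise join $\vee$; $fg:=f\circ g$; $\mathrm{id}$ is the identity; $\top$ maps $0$ to $0$ and every $p\ne 0$ to $\omega$. The residuals $\backslash,/$ satisfy $f\le h/g \iff fg\le h\iff g\le f\backslash h$. For a time warp $f$ define $f^{\ell}:=\mathrm{id}/f$, $f^{r}:=f\backslash\mathrm{id}$ and $f^{o}:=\top\backslash f$. -}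

module Defs where

open import Data.Nat using (ℕ; zero; suc; _≤_)
open import Data.Product using (_×_)
open import Relation.Binary.PropositionalEquality using (_≡_)

data ω̄ : Set where
  fin : ℕ → ω̄
  ω   : ω̄

data _≤ω_ : ω̄ → ω̄ → Set where
  fin≤fin : ∀ {m n} → m ≤ n → fin m ≤ω fin n
  _≤ω-top : ∀ x → x ≤ω ω

_⊔ω_ : ω̄ → ω̄ → ω̄
fin zero    ⊔ω y           = y
fin (suc m) ⊔ω fin zero    = fin (suc m)
fin (suc m) ⊔ω fin (suc n) with fin m ⊔ω fin n
... | fin k = fin (suc k)
... | ω     = ω
fin (suc m) ⊔ω ω           = ω
ω           ⊔ω y           = ω

infixl 6 _⊔ω_

_≤f_ : (ω̄ → ω̄) → (ω̄ → ω̄) → Set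
f ≤f g = ∀ x → f x ≤ω g x

record TimeWarp : Set where
  field
    fun       : ω̄ → ω̄
    mono      : ∀ {x y} → x ≤ω y → fun x ≤ω fun y
    strict    : fun (fin 0) ≡ fin 0
    sup-ub    : ∀ n → fun (fin n) ≤ω fun ω
    sup-least : ∀ b → (∀ n → fun (fin n) ≤ω b) → fun ω ≤ω b
open TimeWarp public

top : ω̄ → ω̄
top (fin zero) = fin zero
top _          = ω

idω : ω̄ → ω̄
idω x = x

_∘ω_ : (ω̄ → ω̄) → (ω̄ → ω̄) → ω̄ → ω̄
(f ∘ω g) x = f (g x)

-- k is the right residual f \ h in W:  g ≤ k ⇔ f g ≤ h  for all time warps g
IsRightRes : (f h : ω̄ → ω̄) → TimeWarp → Set
IsRightRes f h k = ∀ (g : TimeWarp) →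
  ((fun g ≤f fun k → (f ∘ω fun g) ≤f h) × ((f ∘ω fun g) ≤f h → fun g ≤f fun k))

-- k is the left residual h / g in W:  f ≤ k ⇔ f g ≤ h  for all time warps f
IsLeftRes : (h g : ω̄ → ω̄) → TimeWarp → Set
IsLeftRes h g k = ∀ (f : TimeWarp) →
  ((fun f ≤f fun k → (fun f ∘ω g) ≤f h) × ((fun f ∘ω g) ≤f h → fun f ≤f fun k))

-- A time warp is determined by its values at successor points p = n + 1, and at such a p a
-- residual is characterised by testing against the step warps that are 0 up to n and v beyond:
-- v ≤ (f \ h) p iff f v ≤ h p, and v ≤ (h / g) p iff v ≤ h x whenever p ≤ g x.  In (a) one
-- summand then dominates according as g p is 0, positive or ω (namely tfr p, fr (g p), go p = ω)
-- and it equals fg p.  In (b), gf p = g (fl p) when fl p is finite, because the infimum defining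
-- fl p is then attained, while gf p = ω = flo p when fl p = ω.
module Submission where

open import Defs
open import Data.Nat using (ℕ; zero; suc; z≤n; _≤?_; _⊔_)
import Data.Nat.Properties as ℕ
open import Data.Product using (_×_; _,_; proj₁; proj₂)
open import Data.Sum using (_⊎_; inj₁; inj₂)
open import Data.Empty using (⊥-elim)
open import Relation.Nullary using (¬_; Dec; yes; no)
open import Relation.Binary.Core using (_Preserves_⟶_)
open import Relation.Binary.PropositionalEquality
  using (_≡_; refl; sym; cong; subst; module ≡-Reasoning)

open ≡-Reasoning

≤ω-refl : ∀ x → x ≤ω x
≤ω-refl (fin n) = fin≤fin ℕ.≤-refl
≤ω-refl ω       = ω ≤ω-top

≤ω-trans : ∀ {x y z} → x ≤ω y → y ≤ω z → x ≤ω z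
≤ω-trans (fin≤fin p) (fin≤fin q) = fin≤fin (ℕ.≤-trans p q)
≤ω-trans {x} _ (_ ≤ω-top)        = x ≤ω-top

≤ω-antisym : ∀ {x y} → x ≤ω y → y ≤ω x → x ≡ y
≤ω-antisym (fin≤fin p) (fin≤fin q) = cong fin (ℕ.≤-antisym p q)
≤ω-antisym (ω ≤ω-top)  _           = refl

z≤ω : ∀ x → fin 0 ≤ω x
z≤ω (fin n) = fin≤fin z≤n
z≤ω ω       = fin 0 ≤ω-top

≤0⇒≡0 : ∀ {x} → x ≤ω fin 0 → x ≡ fin 0
≤0⇒≡0 (fin≤fin z≤n) = refl

ω≤⇒≡ω : ∀ {x} → ω ≤ω x → x ≡ ω
ω≤⇒≡ω (ω ≤ω-top) = refl

_≤ω?_ : ∀ x y → Dec (x ≤ω y)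
x     ≤ω? ω     = yes (x ≤ω-top)
ω     ≤ω? fin n = no λ ()
fin m ≤ω? fin n with m ≤? n
... | yes m≤n = yes (fin≤fin m≤n)
... | no  m≰n = no λ { (fin≤fin m≤n) → m≰n m≤n }

suc≤⇒≰ : ∀ {n x} → fin (suc n) ≤ω x → ¬ (x ≤ω fin n)
suc≤⇒≰ p q with ≤ω-trans p q
... | fin≤fin 1+n≤n = ℕ.1+n≰n 1+n≤n

≰⇒suc≤ : ∀ {n} x → ¬ (x ≤ω fin n) → fin (suc n) ≤ω x
≰⇒suc≤ (fin m) x≰n = fin≤fin (ℕ.≰⇒> λ m≤n → x≰n (fin≤fin m≤n))
≰⇒suc≤ ω       _   = _ ≤ω-top

suc≰⇒≤ : ∀ {n} x → ¬ (fin (suc n) ≤ω x) → x ≤ω fin n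
suc≰⇒≤ {n} x suc≰x with x ≤ω? fin n
... | yes x≤n = x≤n
... | no  x≰n = ⊥-elim (suc≰x (≰⇒suc≤ x x≰n))

top≤fin⇒≡0 : ∀ {x m} → top x ≤ω fin m → x ≡ fin 0
top≤fin⇒≡0 {fin zero} _ = refl

⊔ω-fin : ∀ m n → fin m ⊔ω fin n ≡ fin (m ⊔ n)
⊔ω-fin zero    n       = refl
⊔ω-fin (suc m) zero    = refl
⊔ω-fin (suc m) (suc n) rewrite ⊔ω-fin m n = refl

⊔ω-zeroʳ : ∀ x → x ⊔ω ω ≡ ω
⊔ω-zeroʳ (fin zero)    = refl
⊔ω-zeroʳ (fin (suc m)) = refl
⊔ω-zeroʳ ω             = refl

x≤x⊔y : ∀ x y → x ≤ω (x ⊔ω y)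
x≤x⊔y ω       y       = ω ≤ω-top
x≤x⊔y (fin m) ω       rewrite ⊔ω-zeroʳ (fin m) = _ ≤ω-top
x≤x⊔y (fin m) (fin n) rewrite ⊔ω-fin m n = fin≤fin (ℕ.m≤m⊔n m n)

y≤x⊔y : ∀ x y → y ≤ω (x ⊔ω y)
y≤x⊔y ω       y       = y ≤ω-top
y≤x⊔y (fin m) ω       rewrite ⊔ω-zeroʳ (fin m) = ω ≤ω-top
y≤x⊔y (fin m) (fin n) rewrite ⊔ω-fin m n = fin≤fin (ℕ.m≤n⊔m m n)

⊔ω-lub : ∀ {x y z} → x ≤ω z → y ≤ω z → (x ⊔ω y) ≤ω z
⊔ω-lub {x} {y} _ (_ ≤ω-top) = (x ⊔ω y) ≤ω-top
⊔ω-lub {fin m} {fin n} (fin≤fin m≤z) (fin≤fin n≤z) rewrite ⊔ω-fin m n = fin≤fin (ℕ.⊔-lub m≤z n≤z)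

⊔ω-mono : ∀ {x x′ y y′} → x ≤ω x′ → y ≤ω y′ → (x ⊔ω y) ≤ω (x′ ⊔ω y′)
⊔ω-mono {x′ = x′} {y′ = y′} x≤x′ y≤y′ =
  ⊔ω-lub (≤ω-trans x≤x′ (x≤x⊔y x′ y′)) (≤ω-trans y≤y′ (y≤x⊔y x′ y′))

x≥y⇒x⊔y≡x : ∀ {x y} → y ≤ω x → x ⊔ω y ≡ x
x≥y⇒x⊔y≡x {x} y≤x = ≤ω-antisym (⊔ω-lub (≤ω-refl x) y≤x) (x≤x⊔y x _)

⊔ω-identityʳ : ∀ x → x ⊔ω fin 0 ≡ x
⊔ω-identityʳ x = x≥y⇒x⊔y≡x (z≤ω x)

stepFun : ℕ → ω̄ → ω̄ → ω̄
stepFun n v x with x ≤ω? fin n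
... | yes _ = fin 0
... | no  _ = v

step-view : ∀ n v x → (x ≤ω fin n × stepFun n v x ≡ fin 0) ⊎ (fin (suc n) ≤ω x × stepFun n v x ≡ v)
step-view n v x with x ≤ω? fin n
... | yes x≤n = inj₁ (x≤n , refl)
... | no  x≰n = inj₂ (≰⇒suc≤ x x≰n , refl)

step-at-suc : ∀ n v → stepFun n v (fin (suc n)) ≡ v
step-at-suc n v with step-view n v (fin (suc n))
... | inj₁ (suc≤n , _) = ⊥-elim (suc≤⇒≰ (≤ω-refl _) suc≤n)
... | inj₂ (_ , eq)    = eq

step-at-zero : ∀ n v → stepFun n v (fin 0) ≡ fin 0
step-at-zero n v with step-view n v (fin 0)
... | inj₁ (_ , eq) = eq
... | inj₂ (fin≤fin () , _)

step-mono : ∀ n v → stepFun n v Preserves _≤ω_ ⟶ _≤ω_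
step-mono n v {x} {y} x≤y with step-view n v x | step-view n v y
... | inj₁ (_ , eq) | _ rewrite eq = z≤ω _
... | inj₂ (suc≤x , _) | inj₁ (y≤n , _) = ⊥-elim (suc≤⇒≰ (≤ω-trans suc≤x x≤y) y≤n)
... | inj₂ (_ , eq) | inj₂ (_ , eq′) rewrite eq | eq′ = ≤ω-refl v

step : ℕ → ω̄ → TimeWarp
step n v = record
  { fun       = stepFun n v
  ; mono      = step-mono n v
  ; strict    = step-at-zero n v
  ; sup-ub    = λ k → step-mono n v (fin k ≤ω-top)
  ; sup-least = λ b bounded → subst (_≤ω b) (step-at-suc n v) (bounded (suc n))
  }

step≤warp : (K : TimeWarp) → ∀ {n v} → v ≤ω fun K (fin (suc n)) → fun (step n v) ≤f fun K
step≤warp K {n} {v} v≤K x with step-view n v x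
... | inj₁ (_ , eq)     rewrite eq = z≤ω _
... | inj₂ (suc≤x , eq) rewrite eq = ≤ω-trans v≤K (mono K suc≤x)

module RightResidual (F H : ω̄ → ω̄) (K : TimeWarp) (res : IsRightRes F H K) where

  sound : ∀ {n v} → v ≤ω fun K (fin (suc n)) → F v ≤ω H (fin (suc n))
  sound {n} {v} v≤K =
    subst (λ y → F y ≤ω H (fin (suc n))) (step-at-suc n v)
      (proj₁ (res (step n v)) (step≤warp K v≤K) (fin (suc n)))

  greatest : F (fin 0) ≡ fin 0 → H Preserves _≤ω_ ⟶ _≤ω_ →
                      ∀ {n v} → F v ≤ω H (fin (suc n)) → v ≤ω fun K (fin (suc n))
  greatest F-strict H-mono {n} {v} Fv≤H =
    subst (_≤ω fun K (fin (suc n))) (step-at-suc n v)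
      (proj₂ (res (step n v)) F∘step≤H (fin (suc n)))
    where
    F∘step≤H : (F ∘ω stepFun n v) ≤f H
    F∘step≤H x with step-view n v x
    ... | inj₁ (_ , eq)     rewrite eq | F-strict = z≤ω _
    ... | inj₂ (suc≤x , eq) rewrite eq = ≤ω-trans Fv≤H (H-mono suc≤x)

module LeftResidual (H G : ω̄ → ω̄) (K : TimeWarp) (res : IsLeftRes H G K) where

  sound : ∀ {n v} → v ≤ω fun K (fin (suc n)) → ∀ x → fin (suc n) ≤ω G x → v ≤ω H x
  sound {n} {v} v≤K x suc≤Gx with step-view n v (G x)
  ... | inj₁ (Gx≤n , _) = ⊥-elim (suc≤⇒≰ suc≤Gx Gx≤n)
  ... | inj₂ (_ , eq)   = subst (_≤ω H x) eq (proj₁ (res (step n v)) (step≤warp K v≤K) x)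

  greatest : ∀ {n v} → (∀ x → fin (suc n) ≤ω G x → v ≤ω H x) → v ≤ω fun K (fin (suc n))
  greatest {n} {v} below-H =
    subst (_≤ω fun K (fin (suc n))) (step-at-suc n v)
      (proj₂ (res (step n v)) step∘G≤H (fin (suc n)))
    where
    step∘G≤H : (stepFun n v ∘ω G) ≤f H
    step∘G≤H x with step-view n v (G x)
    ... | inj₁ (_ , eq)     rewrite eq = z≤ω _
    ... | inj₂ (suc≤Gx , eq) rewrite eq = below-H x suc≤Gx

∘-sup-least : (F G : TimeWarp) → ∀ c → (∀ n → fun F (fun G (fin n)) ≤ω c) → fun F (fun G ω) ≤ω c
∘-sup-least F G c bounded = below-Gω (fun G ω) (≤ω-refl _)
  where
  -- If F (k + 1) ≰ c, no G n reaches k + 1, so neither does their supremum G ω.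
  at-fin : ∀ k → fin k ≤ω fun G ω → fun F (fin k) ≤ω c
  at-fin zero _ = subst (_≤ω c) (sym (strict F)) (z≤ω c)
  at-fin (suc j) k≤Gω with fun F (fin (suc j)) ≤ω? c
  ... | yes Fk≤c = Fk≤c
  ... | no  Fk≰c = ⊥-elim (suc≤⇒≰ k≤Gω (sup-least G (fin j) λ n →
                     suc≰⇒≤ _ λ k≤Gn → Fk≰c (≤ω-trans (mono F k≤Gn) (bounded n))))
  below-Gω : ∀ x → x ≤ω fun G ω → fun F x ≤ω c
  below-Gω (fin k) = at-fin k
  below-Gω ω ω≤Gω  = sup-least F c λ k → at-fin k (≤ω-trans (fin k ≤ω-top) ω≤Gω)

infixr 9 _∘ʷ_
infixl 6 _∨ʷ_

_∘ʷ_ : TimeWarp → TimeWarp → TimeWarp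
F ∘ʷ G = record
  { fun       = fun F ∘ω fun G
  ; mono      = λ x≤y → mono F (mono G x≤y)
  ; strict    = subst (λ y → fun F y ≡ fin 0) (sym (strict G)) (strict F)
  ; sup-ub    = λ n → mono F (sup-ub G n)
  ; sup-least = ∘-sup-least F G
  }

_∨ʷ_ : TimeWarp → TimeWarp → TimeWarp
F ∨ʷ G = record
  { fun       = λ x → fun F x ⊔ω fun G x
  ; mono      = λ x≤y → ⊔ω-mono (mono F x≤y) (mono G x≤y)
  ; strict    = subst (λ y → y ⊔ω fun G (fin 0) ≡ fin 0) (sym (strict F)) (strict G)
  ; sup-ub    = λ n → ⊔ω-mono (sup-ub F n) (sup-ub G n)
  ; sup-least = λ b bounded →
      ⊔ω-lub (sup-least F b λ n → ≤ω-trans (x≤x⊔y (fun F (fin n)) (fun G (fin n))) (bounded n))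
             (sup-least G b λ n → ≤ω-trans (y≤x⊔y (fun F (fin n)) (fun G (fin n))) (bounded n))
  }

warp-ext : (F G : TimeWarp) → (∀ n → fun F (fin (suc n)) ≡ fun G (fin (suc n))) → ∀ p → fun F p ≡ fun G p
warp-ext F G agree-suc = agree
  where
  agree-fin : ∀ n → fun F (fin n) ≡ fun G (fin n)
  agree-fin zero    = begin fun F (fin 0) ≡⟨ strict F ⟩ fin 0 ≡⟨ sym (strict G) ⟩ fun G (fin 0) ∎
  agree-fin (suc n) = agree-suc n

  sup≤sup : (A B : TimeWarp) → (∀ n → fun A (fin n) ≡ fun B (fin n)) → fun A ω ≤ω fun B ω
  sup≤sup A B eq = sup-least A (fun B ω) λ n → subst (_≤ω fun B ω) (sym (eq n)) (sup-ub B n)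

  agree : ∀ p → fun F p ≡ fun G p
  agree (fin n) = agree-fin n
  agree ω       = ≤ω-antisym (sup≤sup F G agree-fin) (sup≤sup G F λ n → sym (agree-fin n))

module RightResidualDecomposition
  (f g fg fr tfr go : TimeWarp)
  (fg-res : IsRightRes (fun f) (fun g) fg) (fr-res : IsRightRes (fun f) idω fr)
  (tfr-res : IsRightRes (top ∘ω fun f) idω tfr) (go-res : IsRightRes top (fun g) go) where

  module FG  = RightResidual (fun f) (fun g) fg fg-res
  module FR  = RightResidual (fun f) idω fr fr-res
  module TFR = RightResidual (top ∘ω fun f) idω tfr tfr-res
  module GO  = RightResidual top (fun g) go go-res

  module _ (n : ℕ) where

    private
      P : ω̄
      P = fin (suc n)

    tfr≤fg : fun tfr P ≤ω fun fg P
    tfr≤fg = FG.greatest (strict f) (mono g)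
               (subst (_≤ω fun g P) (sym f∘tfr≡0) (z≤ω _))
      where
      f∘tfr≡0 : fun f (fun tfr P) ≡ fin 0
      f∘tfr≡0 = top≤fin⇒≡0 (TFR.sound (≤ω-refl _))

    go≡0 : ∀ {m} → fun g P ≡ fin m → fun go P ≡ fin 0
    go≡0 eq = top≤fin⇒≡0 (subst (top (fun go P) ≤ω_) eq (GO.sound (≤ω-refl _)))

    go≡ω : fun g P ≡ ω → fun go P ≡ ω
    go≡ω eq = ω≤⇒≡ω (GO.greatest refl (mono g) (subst (ω ≤ω_) (sym eq) (ω ≤ω-top)))

    fg≡ω : fun g P ≡ ω → fun fg P ≡ ω
    fg≡ω eq = ω≤⇒≡ω (FG.greatest (strict f) (mono g) (subst (_ ≤ω_) (sym eq) (_ ≤ω-top)))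

    fg≡tfr : fun g P ≡ fin 0 → fun fg P ≡ fun tfr P
    fg≡tfr eq = ≤ω-antisym (TFR.greatest (cong top (strict f)) (λ x≤y → x≤y) top∘f∘fg≤P) tfr≤fg
      where
      f∘fg≡0 : fun f (fun fg P) ≡ fin 0
      f∘fg≡0 = ≤0⇒≡0 (subst (fun f (fun fg P) ≤ω_) eq (FG.sound (≤ω-refl _)))
      top∘f∘fg≤P : top (fun f (fun fg P)) ≤ω P
      top∘f∘fg≤P = subst (λ y → top y ≤ω P) (sym f∘fg≡0) (z≤ω P)

    fg≡fr∘g : ∀ {m} → fun g P ≡ fin (suc m) → fun fg P ≡ fun fr (fin (suc m))
    fg≡fr∘g eq = ≤ω-antisym
      (FR.greatest (strict f) (λ x≤y → x≤y)
        (subst (fun f (fun fg P) ≤ω_) eq (FG.sound (≤ω-refl _))))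
      (FG.greatest (strict f) (mono g)
        (subst (fun f (fun fr _) ≤ω_) (sym eq) (FR.sound (≤ω-refl _))))

    decomposition-at-suc : fun fg P ≡ fun fr (fun g P) ⊔ω fun tfr P ⊔ω fun go P
    decomposition-at-suc with fun g P in eq
    ... | fin zero = begin
      fun fg P                                 ≡⟨ fg≡tfr eq ⟩
      fun tfr P                                ≡⟨ sym (⊔ω-identityʳ _) ⟩
      fun tfr P ⊔ω fin 0                       ≡⟨ cong (fun tfr P ⊔ω_) (sym (go≡0 eq)) ⟩
      fun tfr P ⊔ω fun go P                    ≡⟨ cong (λ y → y ⊔ω fun tfr P ⊔ω fun go P) (sym (strict fr)) ⟩
      fun fr (fin 0) ⊔ω fun tfr P ⊔ω fun go P  ∎
    ... | fin (suc m) = begin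
      fun fg P                                         ≡⟨ fg≡fr∘g eq ⟩
      fun fr (fin (suc m))                             ≡⟨ sym (x≥y⇒x⊔y≡x (subst (fun tfr P ≤ω_) (fg≡fr∘g eq) tfr≤fg)) ⟩
      fun fr (fin (suc m)) ⊔ω fun tfr P                ≡⟨ sym (⊔ω-identityʳ _) ⟩
      fun fr (fin (suc m)) ⊔ω fun tfr P ⊔ω fin 0       ≡⟨ cong (fun fr (fin (suc m)) ⊔ω fun tfr P ⊔ω_) (sym (go≡0 eq)) ⟩
      fun fr (fin (suc m)) ⊔ω fun tfr P ⊔ω fun go P    ∎
    ... | ω = begin
      fun fg P                                ≡⟨ fg≡ω eq ⟩
      ω                                       ≡⟨ sym (⊔ω-zeroʳ (fun fr ω ⊔ω fun tfr P)) ⟩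
      fun fr ω ⊔ω fun tfr P ⊔ω ω              ≡⟨ cong (fun fr ω ⊔ω fun tfr P ⊔ω_) (sym (go≡ω eq)) ⟩
      fun fr ω ⊔ω fun tfr P ⊔ω fun go P       ∎

  decomposition : ∀ p → fun fg p ≡ fun fr (fun g p) ⊔ω fun tfr p ⊔ω fun go p
  decomposition = warp-ext fg (fr ∘ʷ g ∨ʷ tfr ∨ʷ go) decomposition-at-suc

module LeftResidualDecomposition
  (f g gf fl flo : TimeWarp)
  (gf-res : IsLeftRes (fun g) (fun f) gf) (fl-res : IsLeftRes idω (fun f) fl)
  (flo-res : IsRightRes top (fun fl) flo) where

  module GF  = LeftResidual (fun g) (fun f) gf gf-res
  module FL  = LeftResidual idω (fun f) fl fl-res
  module FLO = RightResidual top (fun fl) flo flo-res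

  module _ (n : ℕ) where

    private
      P : ω̄
      P = fin (suc n)

    fl-attained : ∀ {m} → fun fl P ≡ fin m → P ≤ω fun f (fin m)
    fl-attained {m} eq with P ≤ω? fun f (fin m)
    ... | yes P≤fm = P≤fm
    ... | no  P≰fm = ⊥-elim (suc≤⇒≰ (subst (fin (suc m) ≤ω_) eq (FL.greatest beyond-m)) (≤ω-refl _))
      where
      beyond-m : ∀ x → P ≤ω fun f x → fin (suc m) ≤ω x
      beyond-m x P≤fx with x ≤ω? fin m
      ... | yes x≤m = ⊥-elim (P≰fm (≤ω-trans P≤fx (mono f x≤m)))
      ... | no  x≰m = ≰⇒suc≤ x x≰m

    fl≡ω⇒unreachable : fun fl P ≡ ω → ∀ x → ¬ (P ≤ω fun f x)
    fl≡ω⇒unreachable eq = unreachable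
      where
      unreachable-fin : ∀ k → ¬ (P ≤ω fun f (fin k))
      unreachable-fin k P≤fk with FL.sound (subst (ω ≤ω_) (sym eq) (ω ≤ω-top)) (fin k) P≤fk
      ... | ()
      unreachable : ∀ x → ¬ (P ≤ω fun f x)
      unreachable (fin k) = unreachable-fin k
      unreachable ω P≤fω  = suc≤⇒≰ P≤fω (sup-least f (fin n) λ k → suc≰⇒≤ _ (unreachable-fin k))

    g∘fl≤gf : fun g (fun fl P) ≤ω fun gf P
    g∘fl≤gf = GF.greatest λ x P≤fx → mono g (FL.sound (≤ω-refl _) x P≤fx)

    gf≡g∘fl : ∀ {m} → fun fl P ≡ fin m → fun gf P ≡ fun g (fin m)
    gf≡g∘fl {m} eq = ≤ω-antisym
      (GF.sound (≤ω-refl _) (fin m) (fl-attained eq))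
      (subst (λ y → fun g y ≤ω fun gf P) eq g∘fl≤gf)

    gf≡ω : fun fl P ≡ ω → fun gf P ≡ ω
    gf≡ω eq = ω≤⇒≡ω (GF.greatest λ x P≤fx → ⊥-elim (fl≡ω⇒unreachable eq x P≤fx))

    flo≡0 : ∀ {m} → fun fl P ≡ fin m → fun flo P ≡ fin 0
    flo≡0 eq = top≤fin⇒≡0 (subst (top (fun flo P) ≤ω_) eq (FLO.sound (≤ω-refl _)))

    flo≡ω : fun fl P ≡ ω → fun flo P ≡ ω
    flo≡ω eq = ω≤⇒≡ω (FLO.greatest refl (mono fl) (subst (ω ≤ω_) (sym eq) (ω ≤ω-top)))

    decomposition-at-suc : fun gf P ≡ fun g (fun fl P) ⊔ω fun flo P
    decomposition-at-suc with fun fl P in eq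
    ... | fin m = begin
      fun gf P                   ≡⟨ gf≡g∘fl eq ⟩
      fun g (fin m)              ≡⟨ sym (⊔ω-identityʳ _) ⟩
      fun g (fin m) ⊔ω fin 0     ≡⟨ cong (fun g (fin m) ⊔ω_) (sym (flo≡0 eq)) ⟩
      fun g (fin m) ⊔ω fun flo P ∎
    ... | ω = begin
      fun gf P               ≡⟨ gf≡ω eq ⟩
      ω                      ≡⟨ sym (⊔ω-zeroʳ (fun g ω)) ⟩
      fun g ω ⊔ω ω           ≡⟨ cong (fun g ω ⊔ω_) (sym (flo≡ω eq)) ⟩
      fun g ω ⊔ω fun flo P   ∎

  decomposition : ∀ p → fun gf p ≡ fun g (fun fl p) ⊔ω fun flo p
  decomposition = warp-ext gf (g ∘ʷ fl ∨ʷ flo) decomposition-at-suc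

lemma2p4 : (f g : TimeWarp) →
    (∀ (fg fr tfr go : TimeWarp) →
        IsRightRes (fun f) (fun g) fg →
        IsRightRes (fun f) idω fr →
        IsRightRes (top ∘ω fun f) idω tfr →
        IsRightRes top (fun g) go →
        ∀ p → fun fg p ≡ fun fr (fun g p) ⊔ω fun tfr p ⊔ω fun go p)
    ×
    (∀ (gf fl flo : TimeWarp) →
        IsLeftRes (fun g) (fun f) gf →
        IsLeftRes idω (fun f) fl →
        IsRightRes top (fun fl) flo →
        ∀ p → fun gf p ≡ fun g (fun fl p) ⊔ω fun flo p)
lemma2p4 f g =
  (λ fg fr tfr go → RightResidualDecomposition.decomposition f g fg fr tfr go) ,
  (λ gf fl flo → LeftResidualDecomposition.decomposition f g gf fl flo)
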